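{- Let $T=T_\circ(\mathbb A,\mathbb B)$ be a fully separated tagged component tree with exactly three non-empty canonical subtrees $\langle L_1\rangle$, $\langle L_2\rangle$, $\langle L_3\rangle$. Then all bad links of $T$ can be covered by two paths, one connecting $\langle L_1\rangle$ and $\langle L_2\rangle$ and the other connecting $\langle L_1\rangle$ and $\langle L_3\rangle$; that is, there are two such paths such that every node of every bad link of $T$ lies on one of them.
   Context: $T_\circ(\mathbb A,\mathbb B)$, for circular chromosomes $\mathbb A,\mathbb B$ (circular sequences of oriented markers, no repeats), is the tagged component tree: an unrooted tree whose nodes are bad or good, each carrying a tag set $\subseteq\{A,B\}$, obtained as follows. In the relational diagram of $\mathbb A,\mathbb B$ (a disjoint union of cycles alternating between edges of $\mathbb A$, edges of $\mathbb B$ — each labeled by the markers unique to its chromosome lying between consecutive common-marker extremities — and dotted edges joining the two copies of each common-marker extremity), a cycle is bad if all its $\mathbb A$-edges are traversed in the same direction with respect to a linear reading of $\mathbb A$; cycles interleave if an $\mathbb A$-edge of each lies between two $\mathbb A$-edges of the other; components are interleaving classes, bad if nontrivial (not a single cycle with one $\mathbb A$-edge) and all cycles bad, good otherwise; a component's tag set contains $A$ (resp. $B$) iff some cycle has an $\mathcal A$-run (resp. $\mathcal B$-run), a run being a maximal subpath of a cycle whose first and last edges are labeled and whose labeled edges all carry markers unique to $\mathbb A$ (resp. $\mathbb B$). The chained component tree has a node per component and a square node per maximal chain (sequence of components with the rightmost $\mathbb A$-edge of each immediately followed by the leftmost $\mathbb A$-edge of the next), children of a square node being its chain's components, and a square node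 being the root or a child of the component in which its chain is nested. $T_\circ$ results from flower-contraction: each maximal connected subgraph of good and/or square nodes becomes one good node with the union of tag sets; such a node is deleted if its tag set is empty and it has exactly two neighbours (which are joined), and if it is a leaf its tags are added to its bad neighbour and it is deleted. Leaves are partitioned into classes $L_A,L_B,L_\emptyset,L_{AB}$ by tag set $\{A\},\{B\},\emptyset,\{A,B\}$; $\langle N\rangle$ is the smallest subtree containing node set $N$; the four $\langle L\rangle$ are the canonical subtrees (non-empty if $L\ne\emptyset$). A partition subtree is $\langle\mathcal L\rangle$ for $\mathcal L$ a union of one to four leaf classes; its complementary subtree is $\langle\mathcal L'\rangle$ where $\mathcal L'$ is the set of all leaves not in $\mathcal L$. For two non-empty disjoint partition subtrees the link between them is the unique path in $T$ connecting them; it is a bad link if it contains a bad node. Two non-empty partition subtrees are separated if they are disjoint and their link is bad. A partition subtree is isolated if it is separated from its complementary subtree. A tree with exactly three non-empty canonical subtrees is fully separated if each canonical subtree is isolated. -}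

module Defs where

open import Data.Nat using (ℕ)
open import Data.Fin using (Fin)
open import Data.Bool using (Bool; true; false)
open import Data.Maybe using (Maybe; just)
open import Data.List using (List; []; _∷_; head; last)
open import Data.List.Membership.Propositional using (_∈_)
open import Data.List.Relation.Unary.Unique.Propositional using (Unique)
open import Data.List.Relation.Unary.All using (All)
open import Data.List.Relation.Unary.Any using (Any)
open import Data.Product using (Σ; ∃; _×_; _,_)
open import Data.Sum using (_⊎_)
open import Data.Unit using (⊤)
open import Data.Empty using (⊥)
open import Relation.Nullary using (¬_)
open import Relation.Binary.PropositionalEquality using (_≡_; _≢_)

-- Tag sets ⊆ {A,B}

data Tag : Set where
  tag∅ tagA tagB tagAB : Tag

module _ {n : ℕ} (adj : Fin n → Fin n → Bool) where

  Chain : List (Fin n) → Set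
  Chain []           = ⊥
  Chain (x ∷ [])     = ⊤
  Chain (x ∷ y ∷ r)  = (adj x y ≡ true) × Chain (y ∷ r)

  IsPath : List (Fin n) → Set
  IsPath p = Chain p × Unique p

  PathFromTo : Fin n → Fin n → List (Fin n) → Set
  PathFromTo u v p = IsPath p × head p ≡ just u × last p ≡ just v

  IsTree : Set
  IsTree = (∀ u v → ∃ λ p → PathFromTo u v p)
         × (∀ u v p q → PathFromTo u v p → PathFromTo u v q → p ≡ q)

record TaggedTree : Set where
  field
    size      : ℕ
    adj       : Fin size → Fin size → Bool
    adj-sym   : ∀ u v → adj u v ≡ adj v u
    adj-irr   : ∀ u → adj u u ≡ false
    isTree    : IsTree adj
    bad       : Fin size → Bool
    tag       : Fin size → Tag

module _ (T : TaggedTree) where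
  open TaggedTree T

  Node : Set
  Node = Fin size

  Path : List Node → Set
  Path = IsPath adj

  Leaf : Node → Set
  Leaf v = ∃ λ u → adj v u ≡ true × (∀ w → adj v w ≡ true → w ≡ u)

  Connected : (Node → Bool) → Set
  Connected S = ∀ u v → S u ≡ true → S v ≡ true →
                ∃ λ p → PathFromTo adj u v p × All (λ w → S w ≡ true) p

  -- ⟨N⟩ : the smallest subtree containing the node set N
  -- (a node lies in ⟨N⟩ iff it lies in every subtree containing N)
  Hull : (Node → Set) → Node → Set
  Hull N v = ∀ (S : Node → Bool) → Connected S → (∀ w → N w → S w ≡ true) → S v ≡ true

  LeafClass : Tag → Node → Set
  LeafClass t v = Leaf v × tag v ≡ t

  Canonical : Tag → Node → Set
  Canonical t = Hull (LeafClass t)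

  -- a union of one to four leaf classes, given by its set of tags 𝓛 (non-empty)
  NonEmptyTagSet : (Tag → Bool) → Set
  NonEmptyTagSet 𝓛 = ∃ λ t → 𝓛 t ≡ true

  PartitionSubtree : (Tag → Bool) → Node → Set
  PartitionSubtree 𝓛 = Hull (λ v → Leaf v × 𝓛 (tag v) ≡ true)

  Complementary : (Tag → Bool) → Node → Set
  Complementary 𝓛 = Hull (λ v → Leaf v × 𝓛 (tag v) ≡ false)

  NonEmpty : (Node → Set) → Set
  NonEmpty S = ∃ λ v → S v

  Disjoint : (Node → Set) → (Node → Set) → Set
  Disjoint S R = ∀ v → S v → R v → ⊥

  Connects : (Node → Set) → (Node → Set) → List Node → Set
  Connects S R p = ∃ λ u → ∃ λ w → PathFromTo adj u w p × S u × R w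

  Interior : List Node → List Node
  Interior []           = []
  Interior (x ∷ [])     = []
  Interior (x ∷ y ∷ r)  = init' y r
    where
      init' : Node → List Node → List Node
      init' a []       = []
      init' a (b ∷ bs) = a ∷ init' b bs

  IsLink : (Node → Set) → (Node → Set) → List Node → Set
  IsLink S R p = Connects S R p × All (λ v → ¬ S v × ¬ R v) (Interior p)

  HasBadNode : List Node → Set
  HasBadNode p = Any (λ v → bad v ≡ true) p

  BadLink : List Node → Set
  BadLink p = ∃ λ 𝓛₁ → ∃ λ 𝓛₂ →
      NonEmptyTagSet 𝓛₁ × NonEmptyTagSet 𝓛₂
    × NonEmpty (PartitionSubtree 𝓛₁) × NonEmpty (PartitionSubtree 𝓛₂)
    × Disjoint (PartitionSubtree 𝓛₁) (PartitionSubtree 𝓛₂)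
    × IsLink (PartitionSubtree 𝓛₁) (PartitionSubtree 𝓛₂) p
    × HasBadNode p

  Separated : (Node → Set) → (Node → Set) → Set
  Separated S R = NonEmpty S × NonEmpty R × Disjoint S R
                × (∀ p → IsLink S R p → HasBadNode p)

  Isolated : (Tag → Bool) → Set
  Isolated 𝓛 = Separated (PartitionSubtree 𝓛) (Complementary 𝓛)

  ⟦_⟧ : Tag → Tag → Bool
  ⟦ tag∅ ⟧ tag∅  = true
  ⟦ tagA ⟧ tagA  = true
  ⟦ tagB ⟧ tagB  = true
  ⟦ tagAB ⟧ tagAB = true
  ⟦ _ ⟧ _ = false

  ExactlyThreeCanonical : Tag → Tag → Tag → Set
  ExactlyThreeCanonical t₁ t₂ t₃ =
      t₁ ≢ t₂ × t₁ ≢ t₃ × t₂ ≢ t₃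
    × NonEmpty (Canonical t₁) × NonEmpty (Canonical t₂) × NonEmpty (Canonical t₃)
    × (∀ t → t ≢ t₁ → t ≢ t₂ → t ≢ t₃ → ¬ NonEmpty (Canonical t))

  FullySeparated : Tag → Tag → Tag → Set
  FullySeparated t₁ t₂ t₃ =
    ExactlyThreeCanonical t₁ t₂ t₃
    × Isolated ⟦ t₁ ⟧ × Isolated ⟦ t₂ ⟧ × Isolated ⟦ t₃ ⟧

-- Fix leaves x₁, x₂, x₃ of the three leaf classes and let p, q be the tree paths from x₁ to x₂
-- and to x₃. Every non-empty partition subtree is the hull of some leaves, whose tags must be
-- among t₁, t₂, t₃, so it contains one of the xᵢ. Partition subtrees are convex, hence the link
-- between two disjoint ones lies on the tree path joining the xᵢ and xⱼ they contain, and in a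
-- tree the path from xᵢ to xⱼ lies on the union of the paths from x₁ to xᵢ and to xⱼ, i.e. on
-- p ∪ q.
module Submission where

open import Defs
open import Data.Nat using (ℕ)
open import Data.Fin using (Fin; _≟_)
open import Data.Fin.Properties using (any?; all?)
open import Data.Bool using (true; false)
import Data.Bool as Bool
open import Data.Maybe using (just)
open import Data.List using (List; []; _∷_; _++_; last)
open import Data.List.Properties using (∷-injectiveʳ)
open import Data.List.Membership.Propositional using (_∈_)
open import Data.List.Membership.Propositional.Properties using (∈-++⁺ˡ; ∈-++⁺ʳ; ∈-++⁻)
open import Data.List.Relation.Binary.Subset.Propositional using (_⊆_)
open import Data.List.Relation.Binary.Subset.Propositional.Properties
  using (xs⊆xs++ys; xs⊆ys++xs)
open import Data.List.Relation.Unary.All as All using (All; []; _∷_)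
open import Data.List.Relation.Unary.All.Properties using () renaming (++⁺ to All-++⁺)
open import Data.List.Relation.Unary.Any using (here; there)
open import Data.List.Relation.Unary.AllPairs as AllPairs using ([]; _∷_)
open import Data.List.Relation.Unary.Unique.Propositional using (Unique)
open import Data.List.Relation.Unary.Unique.Propositional.Properties
  using (++⁺; Unique[x∷xs]⇒x∉xs)
open import Data.Product using (∃; _×_; _,_; proj₁; proj₂)
open import Data.Sum as Sum using (_⊎_; inj₁; inj₂; [_,_]′)
open import Data.Empty using (⊥-elim)
open import Data.Unit using (tt)
open import Function using (_∘_; id)
open import Relation.Nullary using (¬_; Dec; yes; no; _×-dec_; _→-dec_)
open import Relation.Binary.PropositionalEquality
  using (_≡_; _≢_; refl; sym; trans; cong; subst)

_≟ᵗ_ : (s t : Tag) → Dec (s ≡ t)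
tag∅  ≟ᵗ tag∅  = yes refl
tag∅  ≟ᵗ tagA  = no λ ()
tag∅  ≟ᵗ tagB  = no λ ()
tag∅  ≟ᵗ tagAB = no λ ()
tagA  ≟ᵗ tag∅  = no λ ()
tagA  ≟ᵗ tagA  = yes refl
tagA  ≟ᵗ tagB  = no λ ()
tagA  ≟ᵗ tagAB = no λ ()
tagB  ≟ᵗ tag∅  = no λ ()
tagB  ≟ᵗ tagA  = no λ ()
tagB  ≟ᵗ tagB  = yes refl
tagB  ≟ᵗ tagAB = no λ ()
tagAB ≟ᵗ tag∅  = no λ ()
tagAB ≟ᵗ tagA  = no λ ()
tagAB ≟ᵗ tagB  = no λ ()
tagAB ≟ᵗ tagAB = yes refl

module _ {A : Set} where

  end : A → List A → A
  end x []       = x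
  end _ (y ∷ ys) = end y ys

  last-∷ : ∀ x xs → last (x ∷ xs) ≡ just (end x xs)
  last-∷ x []       = refl
  last-∷ x (y ∷ ys) = last-∷ y ys

  end-++ : ∀ x xs ys → end x (xs ++ ys) ≡ end (end x xs) ys
  end-++ x []       ys = refl
  end-++ x (y ∷ xs) ys = end-++ y xs ys

  end-∈ : ∀ x xs → end x xs ∈ x ∷ xs
  end-∈ x []       = here refl
  end-∈ x (y ∷ ys) = there (end-∈ y ys)

  unique-++⁺-separating : ∀ {P : A → Set} {xs ys} → Unique xs → Unique ys →
    All P xs → All (¬_ ∘ P) ys → Unique (xs ++ ys)
  unique-++⁺-separating ux uy Pxs ¬Pys =
    ++⁺ ux uy λ (v∈xs , v∈ys) → All.lookup ¬Pys v∈ys (All.lookup Pxs v∈xs)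

module Walks {n : ℕ} (adj : Fin n → Fin n → Bool.Bool) where

  open import Data.List.Membership.DecPropositional (_≟_ {n}) using (_∈?_)

  Walk : Fin n → List (Fin n) → Fin n → Set
  Walk a xs b = Chain adj (a ∷ xs) × end a xs ≡ b

  SimplePath : Fin n → List (Fin n) → Fin n → Set
  SimplePath a xs b = Walk a xs b × Unique (a ∷ xs)

  simplePath⇒pathFromTo : ∀ {a xs b} → SimplePath a xs b → PathFromTo adj a b (a ∷ xs)
  simplePath⇒pathFromTo {a} {xs} ((c , refl) , u) = (c , u) , refl , last-∷ a xs

  pathFromTo⇒simplePath : ∀ {a b p} → PathFromTo adj a b p →
    ∃ λ xs → p ≡ a ∷ xs × SimplePath a xs b
  pathFromTo⇒simplePath {p = x ∷ xs} ((c , u) , refl , x∷xs↦b) =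
    xs , refl , (c , just-injective (trans (sym (last-∷ x xs)) x∷xs↦b)) , u
    where
      just-injective : ∀ {y z : Fin n} → just y ≡ just z → y ≡ z
      just-injective refl = refl

  walk-++ : ∀ {a xs b ys c} → Walk a xs b → Walk b ys c → Walk a (xs ++ ys) c
  walk-++ {a} {xs} {ys = ys} (c , refl) (c′ , refl) = chain-++ a xs c c′ , end-++ a xs ys
    where
      chain-++ : ∀ x xs → Chain adj (x ∷ xs) → Chain adj (end x xs ∷ ys) →
                 Chain adj (x ∷ xs ++ ys)
      chain-++ x []       _        c′ = c′
      chain-++ x (y ∷ xs) (e , c) c′ = e , chain-++ y xs c c′

  walk-reverse : (∀ u v → adj u v ≡ adj v u) → ∀ {a xs b} → Walk a xs b →
    ∃ λ ys → Walk b ys a × b ∷ ys ⊆ a ∷ xs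
  walk-reverse sym-adj {a} {[]} (_ , refl) = [] , (tt , refl) , id
  walk-reverse sym-adj {a} {y ∷ xs} ((a~y , c) , e)
    with ys , yxs-reversed , ys⊆ ← walk-reverse sym-adj (c , e) =
    ys ++ a ∷ [] ,
    walk-++ yxs-reversed ((trans (sym-adj y a) a~y , tt) , refl) ,
    [ there ∘ ys⊆ , (λ { (here refl) → here refl }) ]′ ∘ ∈-++⁻ (_ ∷ ys)

  simplePath-suffix : ∀ {a xs b v} → SimplePath a xs b → v ∈ a ∷ xs →
    ∃ λ ys → SimplePath v ys b × v ∷ ys ⊆ a ∷ xs
  simplePath-suffix π (here refl) = _ , π , id
  simplePath-suffix {xs = _ ∷ _} (((_ , c) , e) , _ ∷ u) (there v∈xs)
    with ys , π , ⊆xs ← simplePath-suffix ((c , e) , u) v∈xs = ys , π , there ∘ ⊆xs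

  walk⇒simplePath : ∀ {a xs b} → Walk a xs b → ∃ λ ys → SimplePath a ys b × a ∷ ys ⊆ a ∷ xs
  walk⇒simplePath {a} {[]} w = [] , (w , [] ∷ []) , id
  walk⇒simplePath {a} {y ∷ xs} ((a~y , c) , e)
    with ys , ((c′ , e′) , u) , ⊆xs ← walk⇒simplePath (c , e)
       | a ∈? y ∷ ys
  ... | no a∉ = y ∷ ys , (((a~y , c′) , e′) , All.tabulate (λ { m refl → a∉ m }) ∷ u)
              , λ { (here refl) → here refl ; (there m) → there (⊆xs m) }
  ... | yes a∈ with zs , π , ⊆ys ← simplePath-suffix ((c′ , e′) , u) a∈ =
    zs , π , there ∘ ⊆xs ∘ ⊆ys

module Tree (T : TaggedTree) where
  open TaggedTree T
  open Walks adj public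

  path : ∀ a b → ∃ λ xs → SimplePath a xs b
  path a b with xs , _ , σ ← pathFromTo⇒simplePath (proj₂ (proj₁ isTree a b)) = xs , σ

  path-unique : ∀ {a xs ys b} → SimplePath a xs b → SimplePath a ys b → xs ≡ ys
  path-unique σ τ =
    ∷-injectiveʳ (proj₂ isTree _ _ _ _ (simplePath⇒pathFromTo σ) (simplePath⇒pathFromTo τ))

  -- Going from b back to a and on to c is a walk, which must shortcut to the path from b to c.
  path-⊆-++ : ∀ {a xs b ys c zs} → SimplePath a xs b → SimplePath a ys c → SimplePath b zs c →
    b ∷ zs ⊆ (a ∷ xs) ++ (a ∷ ys)
  path-⊆-++ {a} {xs} (ab , _) (ac , _) bc
    with rs , ba , rs⊆ ← walk-reverse adj-sym ab
    with ws , bc′ , ws⊆ ← walk⇒simplePath (walk-++ ba ac)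
    rewrite path-unique bc bc′ =
    [ ∈-++⁺ˡ ∘ rs⊆ , ∈-++⁺ʳ (a ∷ xs) ∘ there ]′ ∘ ∈-++⁻ (_ ∷ rs) ∘ ws⊆

  Convex : (Node T → Set) → Set
  Convex S = ∀ {a xs b} → S a → S b → SimplePath a xs b → All S (a ∷ xs)

  connected-⊇-path : ∀ {S a xs b} → Connected T S → S a ≡ true → S b ≡ true →
    SimplePath a xs b → All (λ v → S v ≡ true) (a ∷ xs)
  connected-⊇-path S-connected Sa Sb σ with S-connected _ _ Sa Sb
  ... | _ , π , inS with _ , refl , τ ← pathFromTo⇒simplePath π rewrite path-unique σ τ = inS

  hull-convex : ∀ N → Convex (Hull T N)
  hull-convex N ha hb σ = All.tabulate λ v∈ S S-connected N⊆S →
    All.lookup (connected-⊇-path S-connected (ha S S-connected N⊆S) (hb S S-connected N⊆S) σ) v∈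

  ∈-tail⇒interior⊎end : ∀ x xs {v} → v ∈ xs → v ∈ Interior T (x ∷ xs) ⊎ v ≡ end x xs
  ∈-tail⇒interior⊎end x (y ∷ [])     (here refl) = inj₂ refl
  ∈-tail⇒interior⊎end x (y ∷ z ∷ zs) (here refl) = inj₁ (here refl)
  ∈-tail⇒interior⊎end x (y ∷ z ∷ zs) (there v∈) =
    Sum.map₁ there (∈-tail⇒interior⊎end y (z ∷ zs) v∈)

  -- The link, extended inside S back to x and inside R on to y, is a simple path: its three
  -- pieces lie in S, outside S ∪ R (except its last node) and in R.
  link-⊆-path : ∀ {S R : Node T → Set} {r x ys y} → Convex S → Convex R → Disjoint T S R →
    IsLink T S R r → S x → R y → SimplePath x ys y → r ⊆ x ∷ ys
  link-⊆-path {S} {R} {x = x} {y = y} S-convex R-convex S∩R=∅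
              ((u , w , uw-path , Su , Rw) , avoids) Sx Ry xy
    with rs , refl , uw ← pathFromTo⇒simplePath uw-path
    with as , xu ← path x u
    with bs , wy ← path w y
    = subst (λ zs → u ∷ rs ⊆ x ∷ zs) (path-unique xuwy xy) r⊆xuwy
    where
      r⊆xuwy : u ∷ rs ⊆ x ∷ as ++ rs ++ bs
      r⊆xuwy (here refl)  = ∈-++⁺ˡ (subst (_∈ x ∷ as) (proj₂ (proj₁ xu)) (end-∈ x as))
      r⊆xuwy (there v∈rs) = there (∈-++⁺ʳ as (∈-++⁺ˡ v∈rs))

      Rbs : All R bs
      Rbs = All.tail (R-convex Rw Ry wy)

      rs-outside : All (λ v → (¬ S v × ¬ R v) ⊎ v ≡ w) rs
      rs-outside = All.tabulate λ v∈rs →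
        Sum.map (All.lookup avoids) (λ e → trans e (proj₂ (proj₁ uw)))
                (∈-tail⇒interior⊎end u rs v∈rs)

      ¬S-rs++bs : All (¬_ ∘ S) (rs ++ bs)
      ¬S-rs++bs = All-++⁺
        (All.map [ proj₁ , (λ { refl Sw → S∩R=∅ w Sw Rw }) ]′ rs-outside)
        (All.map (λ Rv Sv → S∩R=∅ _ Sv Rv) Rbs)

      unique : Unique (x ∷ as ++ rs ++ bs)
      unique = unique-++⁺-separating {xs = x ∷ as} (proj₂ xu)
        (unique-++⁺-separating (AllPairs.tail (proj₂ uw)) (AllPairs.tail (proj₂ wy))
          (All.map (Sum.map₁ proj₂) rs-outside)
          (All.tabulate λ v∈bs → [ (λ ¬Rv → ¬Rv (All.lookup Rbs v∈bs))
                                 , (λ { refl → Unique[x∷xs]⇒x∉xs (proj₂ wy) v∈bs }) ]′))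
        (S-convex Sx Su xu) ¬S-rs++bs

      xuwy : SimplePath x (as ++ rs ++ bs) y
      xuwy = walk-++ (proj₁ xu) (walk-++ (proj₁ uw) (proj₁ wy)) , unique

  PathWithin : Node T → List (Node T) → Node T → Set
  PathWithin a K b = ∃ λ xs → SimplePath a xs b × a ∷ xs ⊆ K

  link-⊆ : ∀ {S R : Node T → Set} {r a K s t} → Convex S → Convex R → Disjoint T S R →
    IsLink T S R r → S s → R t → PathWithin a K s → PathWithin a K t → r ⊆ K
  link-⊆ {s = s} {t} S-convex R-convex S∩R=∅ link Ss Rt (xs , as , as⊆K) (ys , at , at⊆K)
    with zs , st ← path s t =
    [ as⊆K , at⊆K ]′ ∘ ∈-++⁻ (_ ∷ xs) ∘ path-⊆-++ as at st
      ∘ link-⊆-path S-convex R-convex S∩R=∅ link Ss Rt st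

  generator∈hull : ∀ {N : Node T → Set} {v} → N v → Hull T N v
  generator∈hull Nv _ _ N⊆S = N⊆S _ Nv

  -- Without a generator, the empty node set would be a subtree containing all generators.
  hull-generator : ∀ {N : Node T → Set} → (∀ v → Dec (N v)) → NonEmpty T (Hull T N) → ∃ N
  hull-generator N? (v , v∈hull) with any? N?
  ... | yes generator = generator
  ... | no ¬generator with v∈hull (λ _ → false) (λ _ _ ()) (λ w Nw → ⊥-elim (¬generator (w , Nw)))
  ... | ()

  leaf? : ∀ v → Dec (Leaf T v)
  leaf? v = any? λ u →
    (adj v u Bool.≟ true) ×-dec all? λ w → (adj v w Bool.≟ true) →-dec (w ≟ u)

  partitionSubtree-∋-sameClass : ∀ 𝓛 {s t x} → 𝓛 s ≡ true → s ≡ t → LeafClass T t x →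
    PartitionSubtree T 𝓛 x
  partitionSubtree-∋-sameClass 𝓛 𝓛s refl (x-leaf , x-tag) =
    generator∈hull (x-leaf , trans (cong 𝓛 x-tag) 𝓛s)

  canonical-leaf : ∀ {t} → NonEmpty T (Canonical T t) → ∃ (LeafClass T t)
  canonical-leaf {t} = hull-generator λ v → leaf? v ×-dec (tag v ≟ᵗ t)

open Tree using (canonical-leaf)

module ThreeLeaves (T : TaggedTree) {t₁ t₂ t₃ : Tag} {x₁ x₂ x₃ : Node T}
  (L₁ : LeafClass T t₁ x₁) (L₂ : LeafClass T t₂ x₂) (L₃ : LeafClass T t₃ x₃)
  (no-other-leaves : ∀ t → t ≢ t₁ → t ≢ t₂ → t ≢ t₃ → ¬ NonEmpty T (Canonical T t))
  where
  open TaggedTree T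
  open Tree T

  ps qs : List (Node T)
  ps = proj₁ (path x₁ x₂)
  qs = proj₁ (path x₁ x₃)

  x₁→x₂ : SimplePath x₁ ps x₂
  x₁→x₂ = proj₂ (path x₁ x₂)

  x₁→x₃ : SimplePath x₁ qs x₃
  x₁→x₃ = proj₂ (path x₁ x₃)

  p q : List (Node T)
  p = x₁ ∷ ps
  q = x₁ ∷ qs

  connects-p : Connects T (Canonical T t₁) (Canonical T t₂) p
  connects-p = x₁ , x₂ , simplePath⇒pathFromTo x₁→x₂ , generator∈hull L₁ , generator∈hull L₂

  connects-q : Connects T (Canonical T t₁) (Canonical T t₃) q
  connects-q = x₁ , x₃ , simplePath⇒pathFromTo x₁→x₃ , generator∈hull L₁ , generator∈hull L₃

  PathWithin-p∪q : ∀ {y} → y ≡ x₁ ⊎ y ≡ x₂ ⊎ y ≡ x₃ → PathWithin x₁ (p ++ q) y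
  PathWithin-p∪q (inj₁ refl)        = [] , ((tt , refl) , [] ∷ []) , λ { (here refl) → here refl }
  PathWithin-p∪q (inj₂ (inj₁ refl)) = ps , x₁→x₂ , xs⊆xs++ys p q
  PathWithin-p∪q (inj₂ (inj₂ refl)) = qs , x₁→x₃ , xs⊆ys++xs q p

  partitionSubtree-∋xᵢ : ∀ {𝓛} → NonEmpty T (PartitionSubtree T 𝓛) →
    ∃ λ y → PartitionSubtree T 𝓛 y × (y ≡ x₁ ⊎ y ≡ x₂ ⊎ y ≡ x₃)
  partitionSubtree-∋xᵢ {𝓛} nonempty
    with y , y-leaf , 𝓛y ← hull-generator (λ v → leaf? v ×-dec (𝓛 (tag v) Bool.≟ true)) nonempty
    with tag y ≟ᵗ t₁ | tag y ≟ᵗ t₂ | tag y ≟ᵗ t₃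
  ... | yes y∈L₁ | _        | _        =
    x₁ , partitionSubtree-∋-sameClass 𝓛 𝓛y y∈L₁ L₁ , inj₁ refl
  ... | no _     | yes y∈L₂ | _        =
    x₂ , partitionSubtree-∋-sameClass 𝓛 𝓛y y∈L₂ L₂ , inj₂ (inj₁ refl)
  ... | no _     | no _     | yes y∈L₃ =
    x₃ , partitionSubtree-∋-sameClass 𝓛 𝓛y y∈L₃ L₃ , inj₂ (inj₂ refl)
  ... | no y∉L₁ | no y∉L₂ | no y∉L₃ =
    ⊥-elim (no-other-leaves (tag y) y∉L₁ y∉L₂ y∉L₃ (y , generator∈hull (y-leaf , refl)))

  badLink-⊆-p++q : ∀ {r} → BadLink T r → r ⊆ p ++ q
  badLink-⊆-p++q (𝓛₁ , 𝓛₂ , _ , _ , nonempty₁ , nonempty₂ , disjoint , link , _)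
    with s , Ss , s∈xᵢ ← partitionSubtree-∋xᵢ {𝓛₁} nonempty₁
       | t , Rt , t∈xᵢ ← partitionSubtree-∋xᵢ {𝓛₂} nonempty₂ =
    link-⊆ (hull-convex _) (hull-convex _) disjoint link Ss Rt
           (PathWithin-p∪q s∈xᵢ) (PathWithin-p∪q t∈xᵢ)

proposition3 : (T : TaggedTree) (t₁ t₂ t₃ : Tag) →
    FullySeparated T t₁ t₂ t₃ →
    ∃ λ (p : List (Node T)) → ∃ λ (q : List (Node T)) →
        Connects T (Canonical T t₁) (Canonical T t₂) p
      × Connects T (Canonical T t₁) (Canonical T t₃) q
      × (∀ r → BadLink T r → ∀ v → v ∈ r → v ∈ p ⊎ v ∈ q)
proposition3 T t₁ t₂ t₃ ((_ , _ , _ , nonempty₁ , nonempty₂ , nonempty₃ , no-other-leaves) , _)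
  with x₁ , L₁ ← canonical-leaf T nonempty₁
     | x₂ , L₂ ← canonical-leaf T nonempty₂
     | x₃ , L₃ ← canonical-leaf T nonempty₃ =
  p , q , connects-p , connects-q , λ _ bad _ v∈r → ∈-++⁻ p (badLink-⊆-p++q bad v∈r)
  where open ThreeLeaves T L₁ L₂ L₃ no-other-leaves
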